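{- Let $s\in\mathbb{Z}\setminus\{0\}$, $t\in\mathbb{Z}_{\ge1}$ with $\gcd(s,t)=1$. For $n\in\mathbb{Z}_{\ge0}$ let \[ D_n=\prod_{p\text{ prime},\ v_p(s)\ge1}p^{r_p(n)},\qquad r_2(n)=n+1,\quad r_p(n)=v_p((n+1)!)\ (p\ge3). \] Then \[ \frac{\alpha^{n+1}}{\gamma(n+1)^{\beta}}\le D_n\le \gcd(2,s)\,\alpha^{n}. \]
   Context: $v_p$ is the $p$-adic valuation. $\alpha=\prod_{p\text{ prime},\,p\mid s}p^{1/(p-1)}$, $\beta$ is the number of odd primes dividing $s$, and $\gamma=\prod_{p\text{ odd prime},\,p\mid s}p$. -}

module Defs where

open import Data.Nat using (ℕ; zero; suc; _+_; _*_; _^_; _≟_; pred; _!)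
open import Data.Nat.DivMod using (_/_)
open import Data.Nat.Divisibility using (_∣?_; quotient)
open import Data.Nat.Primality using (prime?)
open import Data.List using (List; filter; upTo; map; length)
open import Data.Nat.ListAction using (product)
open import Relation.Nullary using (yes; no; ¬?)
open import Relation.Nullary.Decidable using (_×-dec_)


-- p-adic valuation v_p(m): largest k with p^k ∣ m (v_p(0) := 0; only used for m ≥ 1, p prime).
-- Computed by repeated exact division, with fuel m (enough since p ≥ 2).
vp : ℕ → ℕ → ℕ
vp p m = go m m
  where
  go : ℕ → ℕ → ℕ
  go zero _ = zero
  go (suc f) m with m ≟ 0
  ... | yes _ = zero
  ... | no _ with p ∣? m
  ...   | yes d = suc (go f (quotient d))
  ...   | no _ = zero

primeDivisors : ℕ → List ℕ
primeDivisors m = filter (λ p → prime? p ×-dec (p ∣? m)) (upTo (suc m))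

oddPrimeDivisors : ℕ → List ℕ
oddPrimeDivisors m = filter (λ p → ¬? (p ≟ 2)) (primeDivisors m)

r : ℕ → ℕ → ℕ
r p n with p ≟ 2
... | yes _ = suc n
... | no _ = vp p (suc n !)

-- D_n for a : ℕ standing for |s|
D : ℕ → ℕ → ℕ
D a n = product (map (λ p → p ^ r p n) (primeDivisors a))

β : ℕ → ℕ
β a = length (oddPrimeDivisors a)

γ : ℕ → ℕ
γ a = product (oddPrimeDivisors a)

-- L = ∏_{p ∣ s} (p - 1); a common multiple of all p - 1, so that α^L is an integer
Lexp : ℕ → ℕ
Lexp a = product (map pred (primeDivisors a))

-- division, total (m ÷ 0 := 0); only used with nonzero divisors dividing m
_÷_ : ℕ → ℕ → ℕ
m ÷ zero = zero
m ÷ suc k = m / suc k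

-- α^(k·L) = ∏_{p ∣ s} p^(k·L/(p-1)), an exact integer
alphaPowL : ℕ → ℕ → ℕ
alphaPowL a k = product (map (λ p → p ^ ((k * Lexp a) ÷ pred p)) (primeDivisors a))

{-# OPTIONS --safe #-}
module Submission where

-- Raising to the power L = ∏_{p ∣ s} (p − 1) makes α^L an integer, and both bounds
-- become products over the primes p ∣ s of per-prime inequalities.  For p = 2 the
-- factor is exactly 2^(n+1) = 2 · 2^n.  For odd p, Legendre's recursion
-- v_p(m!) = ⌊m/p⌋ + v_p(⌊m/p⌋!) shows, by induction on the base-p expansion of
-- m = n + 1, that m − (p − 1) v_p(m!) (the base-p digit sum of m) is positive and
-- at most (p − 1) log_p (p m): these give the upper and the lower bound.

import Algebra.Properties.CommutativeSemigroup as CommSemigroupProperties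
open import Data.Bool using (if_then_else_; true; false)
open import Data.Integer using (ℤ; ∣_∣)
open import Data.List using ([]; _∷_; map; filter; length; upTo)
open import Data.List.Membership.Propositional using (_∈_)
open import Data.List.Membership.Propositional.Properties using (∈-filter⁻; ∈-map⁺)
open import Data.List.Relation.Unary.All using (lookup)
open import Data.List.Relation.Unary.AllPairs using ([]; _∷_)
open import Data.List.Relation.Unary.Any using (here; there)
open import Data.List.Relation.Unary.Unique.Propositional using (Unique)
import Data.List.Relation.Unary.Unique.Propositional.Properties as Unique
open import Data.Nat
open import Data.Nat.DivMod using (_/_; _%_; m≡m%n+[m/n]*n; m%n<n; n/1≡n; m*n/n≡m)
open import Data.Nat.Divisibility
open import Data.Nat.GCD using (gcd; gcd[m,n]≢0; gcd[m,n]∣m; gcd-greatest)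
open import Data.Nat.Induction using (<-rec)
open import Data.Nat.ListAction using (product)
open import Data.Nat.ListAction.Properties using (∈⇒∣product)
open import Data.Nat.Primality using (Prime; prime; prime?; prime⇒nonTrivial; euclidsLemma)
open import Data.Nat.Properties
open import Data.Nat.Tactic.RingSolver using (solve-∀)
open import Data.Product using (_×_; _,_; proj₁; proj₂)
open import Data.Sum using (inj₁; inj₂)
open import Function using (_∘′_)
open import Relation.Binary.Definitions using (DecidableEquality)
open import Relation.Binary.PropositionalEquality
open import Relation.Nullary using (¬_; yes; no; does; contradiction)
open import Relation.Nullary.Decidable using (¬?; _×-dec_)
open import Relation.Unary using (Decidable)

open import Defs

private
  module *-CS = CommSemigroupProperties *-commutativeSemigroup
  module +-CS = CommSemigroupProperties +-commutativeSemigroup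

^-distribʳ-* : ∀ m n o → (m * n) ^ o ≡ m ^ o * n ^ o
^-distribʳ-* m n zero    = refl
^-distribʳ-* m n (suc o) = trans (cong (m * n *_) (^-distribʳ-* m n o)) (*-CS.interchange m n (m ^ o) (n ^ o))

[m*[e*d]]÷d≡m*e : ∀ m e d → (m * (e * suc d)) ÷ suc d ≡ m * e
[m*[e*d]]÷d≡m*e m e d = trans (cong (_/ suc d) (sym (*-assoc m e (suc d)))) (m*n/n≡m (m * e) (suc d))

-- `vp` delegates to a fuelled worker local to its where block, which cannot be
-- named; stating this unfolding makes Agda solve the meta `vp-go` as that worker,
-- so that vp p m = vp-go p m m holds definitionally.
mutual
  vp-go : ℕ → ℕ → ℕ → ℕ
  vp-go = _

  vp-unfold : ∀ p m q (e : suc m ≡ q * p) → (p ∣? suc m) ≡ yes (divides q e) →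
              vp p (suc m) ≡ suc (vp-go p m q)
  vp-unfold p m q e eq rewrite eq = refl

vp-go-∤ : ∀ {p f x} → ¬ p ∣ x → 1 ≤ x → x ≤ f → vp-go p f x ≡ 0
vp-go-∤ {p} {suc f} {suc m} p∤x _ _ with p ∣? suc m
... | yes p∣x = contradiction p∣x p∤x
... | no _    = refl

vp-go-*p : ∀ {p} f q → .{{NonZero p}} → .{{NonZero q}} → vp-go p (suc f) (q * p) ≡ suc (vp-go p f q)
vp-go-*p {p@(suc _)} f q@(suc _) with p ∣? q * p
... | yes (divides q′ e) = cong (suc ∘′ vp-go p f) (*-cancelʳ-≡ q′ q p (sym e))
... | no p∤qp = contradiction (divides q refl) p∤qp

vp-∤ : ∀ {p x} → ¬ p ∣ x → 1 ≤ x → vp p x ≡ 0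
vp-∤ p∤x 1≤x = vp-go-∤ p∤x 1≤x ≤-refl

module _ {p c} (1<p : 1 < p) (1≤c : 1 ≤ c) (p∤c : ¬ p ∣ c) where

  private
    instance
      p≢0 = >-nonZero (<-trans z<s 1<p)

    1≤p^k*c : ∀ k → 1 ≤ p ^ k * c
    1≤p^k*c k = *-mono-≤ (m^n>0 p k) 1≤c

  vp-go-p^k*c : ∀ k {f} → p ^ k * c ≤ f → vp-go p f (p ^ k * c) ≡ k
  vp-go-p^k*c zero    le = vp-go-∤ (p∤c ∘′ subst (p ∣_) (*-identityˡ c)) (1≤p^k*c 0) le
  vp-go-p^k*c (suc k) {zero} le = contradiction (≤-trans (1≤p^k*c (suc k)) le) λ ()
  vp-go-p^k*c (suc k) {suc f} le = begin
    vp-go p (suc f) (p ^ suc k * c) ≡⟨ cong (vp-go p (suc f)) (*-CS.xy∙z≈yz∙x p (p ^ k) c) ⟩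
    vp-go p (suc f) (x * p)         ≡⟨ vp-go-*p f x {{p≢0}} {{>-nonZero (1≤p^k*c k)}} ⟩
    suc (vp-go p f x)               ≡⟨ cong suc (vp-go-p^k*c k x≤f) ⟩
    suc k                           ∎
    where
    open ≡-Reasoning
    x = p ^ k * c
    x≤f : x ≤ f
    x≤f = s≤s⁻¹ (≤-trans (m<m*n x p {{>-nonZero (1≤p^k*c k)}} 1<p)
                         (≤-trans (≤-reflexive (sym (*-CS.xy∙z≈yz∙x p (p ^ k) c))) le))

  vp[p^k*c]≡k : ∀ k → vp p (p ^ k * c) ≡ k
  vp[p^k*c]≡k k = vp-go-p^k*c k ≤-refl

data PAdicSplit (p : ℕ) : ℕ → Set where
  split : ∀ k {c} → 1 ≤ c → ¬ p ∣ c → PAdicSplit p (p ^ k * c)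

pAdicSplit : ∀ {p} → 1 < p → ∀ x → 1 ≤ x → PAdicSplit p x
pAdicSplit {p} 1<p = <-rec (λ x → 1 ≤ x → PAdicSplit p x) step
  where
  instance
    p≢0 : NonZero p
    p≢0 = >-nonZero (<-trans z<s 1<p)

  *p : ∀ {y} → PAdicSplit p y → PAdicSplit p (y * p)
  *p (split k 1≤c p∤c) = subst (PAdicSplit p) (*-CS.xy∙z≈yz∙x p (p ^ k) _) (split (suc k) 1≤c p∤c)

  step : ∀ x → (∀ {y} → y < x → 1 ≤ y → PAdicSplit p y) → 1 ≤ x → PAdicSplit p x
  step x rec 1≤x with p ∣? x
  ... | no p∤x = subst (PAdicSplit p) (*-identityˡ x) (split 0 1≤x p∤x)
  ... | yes (divides zero refl) = contradiction 1≤x λ ()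
  ... | yes (divides q@(suc _) refl) = *p (rec (m<m*n q p 1<p) z<s)

module _ {p} (p-prime : Prime p) where

  private
    1<p : 1 < p
    1<p = nonTrivial⇒n>1 p {{prime⇒nonTrivial p-prime}}

  vp-* : ∀ {x y} → 1 ≤ x → 1 ≤ y → vp p (x * y) ≡ vp p x + vp p y
  vp-* {x} {y} 1≤x 1≤y with pAdicSplit 1<p x 1≤x | pAdicSplit 1<p y 1≤y
  ... | split i {a} 1≤a p∤a | split j {b} 1≤b p∤b = begin
    vp p (p ^ i * a * (p ^ j * b))  ≡⟨ cong (vp p) regroup ⟩
    vp p (p ^ (i + j) * (a * b))    ≡⟨ vp[p^k*c]≡k 1<p (*-mono-≤ 1≤a 1≤b) p∤ab (i + j) ⟩
    i + j                           ≡⟨ cong₂ _+_ (vp[p^k*c]≡k 1<p 1≤a p∤a i) (vp[p^k*c]≡k 1<p 1≤b p∤b j) ⟨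
    vp p (p ^ i * a) + vp p (p ^ j * b) ∎
    where
    open ≡-Reasoning
    regroup : p ^ i * a * (p ^ j * b) ≡ p ^ (i + j) * (a * b)
    regroup = trans (*-CS.interchange (p ^ i) a (p ^ j) b) (cong (_* (a * b)) (sym (^-distribˡ-+-* p i j)))
    p∤ab : ¬ p ∣ a * b
    p∤ab p∣ab with euclidsLemma a b p-prime p∣ab
    ... | inj₁ p∣a = p∤a p∣a
    ... | inj₂ p∣b = p∤b p∣b

  vp-!-suc : ∀ m → vp p (suc m !) ≡ vp p (suc m) + vp p (m !)
  vp-!-suc m = vp-* z<s (>-nonZero⁻¹ (m !) {{m !≢0}})

vp[x*p]≡1+vp[x] : ∀ {p x} → 1 < p → 1 ≤ x → vp p (x * p) ≡ suc (vp p x)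
vp[x*p]≡1+vp[x] {p} {x} 1<p 1≤x with pAdicSplit 1<p x 1≤x
... | split k {c} 1≤c p∤c = begin
  vp p (p ^ k * c * p)  ≡⟨ cong (vp p) (*-CS.xy∙z≈yz∙x p (p ^ k) c) ⟨
  vp p (p ^ suc k * c)  ≡⟨ vp[p^k*c]≡k 1<p 1≤c p∤c (suc k) ⟩
  suc k                 ≡⟨ cong suc (vp[p^k*c]≡k 1<p 1≤c p∤c k) ⟨
  suc (vp p (p ^ k * c)) ∎
  where open ≡-Reasoning

module _ {p} (1<p : 1 < p) where

  private instance
    p≢0 = >-nonZero (<-trans z<s 1<p)

  base-induction : (P : ℕ → Set) →
                   (∀ {r} → 1 ≤ r → r < p → P r) →
                   (∀ {q r} → 1 ≤ q → r < p → P q → P (q * p + r)) →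
                   ∀ {m} → 1 ≤ m → P m
  base-induction P digit extend {m} = <-rec (λ m → 1 ≤ m → P m) step m
    where
    from-digits : ∀ q {r} → r < p → (∀ {y} → y < q * p + r → 1 ≤ y → P y) → 1 ≤ q * p + r → P (q * p + r)
    from-digits zero    r<p _   1≤r = digit 1≤r r<p
    from-digits (suc q) {r} r<p rec _ =
      extend z<s r<p (rec (≤-trans (m<m*n (suc q) p 1<p) (m≤m+n (suc q * p) r)) z<s)

    step : ∀ m → (∀ {y} → y < m → 1 ≤ y → P y) → 1 ≤ m → P m
    step m rec 1≤m = subst P m≡q*p+r (from-digits (m / p) (m%n<n m p)
      (λ y< → rec (subst (_ <_) m≡q*p+r y<)) (subst (1 ≤_) (sym m≡q*p+r) 1≤m))
      where
      m≡q*p+r : m / p * p + m % p ≡ m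
      m≡q*p+r = trans (+-comm (m / p * p) (m % p)) (sym (m≡m%n+[m/n]*n m p))

module Legendre {k} (p-prime : Prime (suc k)) where

  private
    p : ℕ
    p = suc k
    1<p : 1 < p
    1<p = nonTrivial⇒n>1 p {{prime⇒nonTrivial p-prime}}

  vp[[q*p+r]!]≡vp[[q*p]!] : ∀ q {r} → r < p → vp p ((q * p + r) !) ≡ vp p ((q * p) !)
  vp[[q*p+r]!]≡vp[[q*p]!] q {zero} _ = cong (vp p ∘′ _!) (+-identityʳ (q * p))
  vp[[q*p+r]!]≡vp[[q*p]!] q {suc r} 1+r<p = begin
    vp p ((q * p + suc r) !)                   ≡⟨ cong (vp p ∘′ _!) (+-suc (q * p) r) ⟩
    vp p (suc (q * p + r) !)                   ≡⟨ vp-!-suc p-prime (q * p + r) ⟩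
    vp p (suc (q * p + r)) + vp p ((q * p + r) !) ≡⟨ cong (_+ vp p ((q * p + r) !)) (vp-∤ p∤ z<s) ⟩
    vp p ((q * p + r) !)                       ≡⟨ vp[[q*p+r]!]≡vp[[q*p]!] q (<-trans (n<1+n r) 1+r<p) ⟩
    vp p ((q * p) !)                           ∎
    where
    open ≡-Reasoning
    p∤ : ¬ p ∣ suc (q * p + r)
    p∤ p∣ = <⇒≱ 1+r<p (∣⇒≤ (∣m+n∣m⇒∣n (subst (p ∣_) (sym (+-suc (q * p) r)) p∣) (n∣m*n q)))

  vp[[q*p]!]≡q+vp[q!] : ∀ q → vp p ((q * p) !) ≡ q + vp p (q !)
  vp[[q*p]!]≡q+vp[q!] zero = refl
  vp[[q*p]!]≡q+vp[q!] (suc q) = begin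
    vp p ((suc q * p) !)                      ≡⟨ cong (vp p ∘′ _!) 1+m≡[1+q]*p ⟨
    vp p (suc m !)                            ≡⟨ vp-!-suc p-prime m ⟩
    vp p (suc m) + vp p (m !)                 ≡⟨ cong₂ _+_ vp[1+m] (vp[[q*p+r]!]≡vp[[q*p]!] q ≤-refl) ⟩
    suc (vp p (suc q)) + vp p ((q * p) !)     ≡⟨ cong (suc (vp p (suc q)) +_) (vp[[q*p]!]≡q+vp[q!] q) ⟩
    suc (vp p (suc q) + (q + vp p (q !)))     ≡⟨ cong suc (+-CS.x∙yz≈y∙xz (vp p (suc q)) q (vp p (q !))) ⟩
    suc q + (vp p (suc q) + vp p (q !))       ≡⟨ cong (suc q +_) (vp-!-suc p-prime q) ⟨
    suc q + vp p (suc q !)                    ∎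
    where
    open ≡-Reasoning
    m = q * p + k
    1+m≡[1+q]*p : suc m ≡ suc q * p
    1+m≡[1+q]*p = cong suc (+-comm (q * p) k)
    vp[1+m] : vp p (suc m) ≡ suc (vp p (suc q))
    vp[1+m] = trans (cong (vp p) 1+m≡[1+q]*p) (vp[x*p]≡1+vp[x] 1<p z<s)

  legendre : ∀ q {r} → r < p → vp p ((q * p + r) !) ≡ q + vp p (q !)
  legendre q r<p = trans (vp[[q*p+r]!]≡vp[[q*p]!] q r<p) (vp[[q*p]!]≡q+vp[q!] q)

  vp[r!]≡0 : ∀ {r} → r < p → vp p (r !) ≡ 0
  vp[r!]≡0 r<p = trans (legendre 0 r<p) (vp-∤ p∤1 z<s)
    where
    p∤1 : ¬ p ∣ 1
    p∤1 p∣1 = nonTrivial⇒≢1 {{prime⇒nonTrivial p-prime}} (∣1⇒≡1 p∣1)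

  vp[m!]*k<m : ∀ {m} → 1 ≤ m → vp p (m !) * k < m
  vp[m!]*k<m = base-induction 1<p (λ m → vp p (m !) * k < m) digit extend
    where
    digit : ∀ {r} → 1 ≤ r → r < p → vp p (r !) * k < r
    digit {r} 1≤r r<p rewrite vp[r!]≡0 r<p = 1≤r

    extend : ∀ {q r} → 1 ≤ q → r < p → vp p (q !) * k < q → vp p ((q * p + r) !) * k < q * p + r
    extend {q} {r} _ r<p ih = begin-strict
      vp p ((q * p + r) !) * k   ≡⟨ cong (_* k) (legendre q r<p) ⟩
      (q + vp p (q !)) * k       ≡⟨ *-distribʳ-+ k q (vp p (q !)) ⟩
      q * k + vp p (q !) * k     <⟨ +-monoʳ-< (q * k) ih ⟩
      q * k + q                  ≡⟨ trans (+-comm (q * k) q) (sym (*-suc q k)) ⟩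
      q * p                      ≤⟨ m≤m+n (q * p) r ⟩
      q * p + r                  ∎
      where open ≤-Reasoning

  p^m≤[p^vp[m!]*pm]^k : ∀ {m} → 1 ≤ m → p ^ m ≤ (p ^ vp p (m !) * (p * m)) ^ k
  p^m≤[p^vp[m!]*pm]^k = base-induction 1<p (λ m → p ^ m ≤ (p ^ vp p (m !) * (p * m)) ^ k) digit extend
    where
    open ≤-Reasoning

    digit : ∀ {r} → 1 ≤ r → r < p → p ^ r ≤ (p ^ vp p (r !) * (p * r)) ^ k
    digit {r} 1≤r r<p rewrite vp[r!]≡0 r<p = begin
      p ^ r              ≤⟨ ^-monoʳ-≤ p (s≤s⁻¹ r<p) ⟩
      p ^ k              ≤⟨ ^-monoˡ-≤ k (m≤m*n p r {{>-nonZero 1≤r}}) ⟩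
      (p * r) ^ k        ≡⟨ cong (_^ k) (*-identityˡ (p * r)) ⟨
      (1 * (p * r)) ^ k  ∎

    extend : ∀ {q r} → 1 ≤ q → r < p → p ^ q ≤ (p ^ vp p (q !) * (p * q)) ^ k →
             p ^ (q * p + r) ≤ (p ^ vp p ((q * p + r) !) * (p * (q * p + r))) ^ k
    extend {q} {r} _ r<p ih = begin
      p ^ (q * p + r)                                ≡⟨ p^[q*p+r] ⟩
      p ^ q * (p ^ q) ^ k * p ^ r                    ≤⟨ *-mono-≤ (*-monoˡ-≤ ((p ^ q) ^ k) ih) (^-monoʳ-≤ p (s≤s⁻¹ r<p)) ⟩
      (a * (p * q)) ^ k * (p ^ q) ^ k * p ^ k        ≡⟨ regroup ⟩
      (p ^ (q + V) * (p * (q * p))) ^ k              ≤⟨ ^-monoˡ-≤ k (*-monoʳ-≤ (p ^ (q + V)) (*-monoʳ-≤ p (m≤m+n (q * p) r))) ⟩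
      (p ^ (q + V) * (p * (q * p + r))) ^ k          ≡⟨ cong (λ e → (p ^ e * (p * (q * p + r))) ^ k) (legendre q r<p) ⟨
      (p ^ vp p ((q * p + r) !) * (p * (q * p + r))) ^ k ∎
      where
      V = vp p (q !)
      a = p ^ V
      p^[q*p+r] : p ^ (q * p + r) ≡ p ^ q * (p ^ q) ^ k * p ^ r
      p^[q*p+r] = begin-equality
        p ^ (q * p + r)          ≡⟨ ^-distribˡ-+-* p (q * p) r ⟩
        p ^ (q * p) * p ^ r      ≡⟨ cong (λ e → p ^ e * p ^ r) (*-suc q k) ⟩
        p ^ (q + q * k) * p ^ r  ≡⟨ cong (_* p ^ r) (^-distribˡ-+-* p q (q * k)) ⟩
        p ^ q * p ^ (q * k) * p ^ r ≡⟨ cong (λ x → p ^ q * x * p ^ r) (^-*-assoc p q k) ⟨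
        p ^ q * (p ^ q) ^ k * p ^ r ∎
      regroup : (a * (p * q)) ^ k * (p ^ q) ^ k * p ^ k ≡ (p ^ (q + V) * (p * (q * p))) ^ k
      regroup = begin-equality
        (a * (p * q)) ^ k * (p ^ q) ^ k * p ^ k ≡⟨ cong (_* p ^ k) (^-distribʳ-* (a * (p * q)) (p ^ q) k) ⟨
        (a * (p * q) * p ^ q) ^ k * p ^ k       ≡⟨ ^-distribʳ-* (a * (p * q) * p ^ q) p k ⟨
        (a * (p * q) * p ^ q * p) ^ k           ≡⟨ cong (_^ k) (commute a (p ^ q) p q) ⟩
        (p ^ q * a * (p * (q * p))) ^ k         ≡⟨ cong (λ x → (x * (p * (q * p))) ^ k) (^-distribˡ-+-* p q V) ⟨
        (p ^ (q + V) * (p * (q * p))) ^ k       ∎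
        where
        commute : ∀ a c p q → a * (p * q) * c * p ≡ c * a * (p * (q * p))
        commute = solve-∀

module _ {A : Set} where

  product-map-mono-≤ : ∀ {f g : A → ℕ} xs → (∀ {x} → x ∈ xs → f x ≤ g x) →
                       product (map f xs) ≤ product (map g xs)
  product-map-mono-≤ []       _   = ≤-refl
  product-map-mono-≤ (x ∷ xs) f≤g = *-mono-≤ (f≤g (here refl)) (product-map-mono-≤ xs (f≤g ∘′ there))

  product-map-^ : ∀ (f : A → ℕ) n xs → product (map f xs) ^ n ≡ product (map (λ x → f x ^ n) xs)
  product-map-^ f n []       = ^-zeroˡ n
  product-map-^ f n (x ∷ xs) = trans (^-distribʳ-* (f x) _ n) (cong (f x ^ n *_) (product-map-^ f n xs))

  product-map-* : ∀ (f g : A → ℕ) xs →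
                  product (map f xs) * product (map g xs) ≡ product (map (λ x → f x * g x) xs)
  product-map-* f g []       = refl
  product-map-* f g (x ∷ xs) =
    trans (*-CS.interchange (f x) _ (g x) _) (cong (f x * g x *_) (product-map-* f g xs))

  product-map-filter : ∀ {P : A → Set} (P? : Decidable P) (f : A → ℕ) xs →
                       product (map f (filter P? xs)) ≡ product (map (λ x → if does (P? x) then f x else 1) xs)
  product-map-filter P? f []       = refl
  product-map-filter P? f (x ∷ xs) with does (P? x)
  ... | true  = cong (f x *_) (product-map-filter P? f xs)
  ... | false = trans (product-map-filter P? f xs) (sym (*-identityˡ _))

  module _ (_≟_ : DecidableEquality A) {f g : A → ℕ} {x₀ : A} {K : ℕ} (1≤K : 1 ≤ K) where

    product-map-≤-*-except : ∀ {xs} → Unique xs → (∀ {x} → x ∈ xs → x ≢ x₀ → f x ≤ g x) →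
                             (x₀ ∈ xs → f x₀ ≤ K * g x₀) → product (map f xs) ≤ K * product (map g xs)
    product-map-≤-*-except {[]} _ _ _ = ≤-trans 1≤K (≤-reflexive (sym (*-identityʳ K)))
    product-map-≤-*-except {x ∷ xs} (x∉xs ∷ unique) f≤g f≤Kg with x ≟ x₀
    ... | yes refl = begin
      f x * product (map f xs)       ≤⟨ *-mono-≤ (f≤Kg (here refl)) (product-map-mono-≤ xs λ y∈xs → f≤g (there y∈xs) (lookup x∉xs y∈xs ∘′ sym)) ⟩
      K * g x * product (map g xs)   ≡⟨ *-assoc K (g x) _ ⟩
      K * (g x * product (map g xs)) ∎
      where open ≤-Reasoning
    ... | no x≢x₀ = begin
      f x * product (map f xs)       ≤⟨ *-mono-≤ (f≤g (here refl) x≢x₀) (product-map-≤-*-except unique (f≤g ∘′ there) (f≤Kg ∘′ there)) ⟩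
      g x * (K * product (map g xs)) ≡⟨ *-CS.x∙yz≈y∙xz (g x) K _ ⟩
      K * (g x * product (map g xs)) ∎
      where open ≤-Reasoning

product-*-^-length : ∀ m xs → product xs * m ^ length xs ≡ product (map (_* m) xs)
product-*-^-length m []       = refl
product-*-^-length m (x ∷ xs) =
  trans (*-CS.interchange x _ m _) (cong (x * m *_) (product-*-^-length m xs))

oddWeight : ℕ → ℕ → ℕ
oddWeight n p = if does (¬? (p ≟ 2)) then p * suc n else 1

γ*[1+n]^β≡product-oddWeight : ∀ a n → γ a * suc n ^ β a ≡ product (map (oddWeight n) (primeDivisors a))
γ*[1+n]^β≡product-oddWeight a n =
  trans (product-*-^-length (suc n) (oddPrimeDivisors a)) (product-map-filter (λ p → ¬? (p ≟ 2)) (_* suc n) (primeDivisors a))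

prime-factor-lower : ∀ {p L} n → Prime p → pred p ∣ L →
                     p ^ ((suc n * L) ÷ pred p) ≤ (p ^ r p n * oddWeight n p) ^ L
prime-factor-lower {0} _ (prime {{()}} _) _
prime-factor-lower {1} _ (prime {{()}} _) _
prime-factor-lower {2} {L} n _ _ = ≤-reflexive (begin
  2 ^ ((suc n * L) / 1)   ≡⟨ cong (2 ^_) (n/1≡n (suc n * L)) ⟩
  2 ^ (suc n * L)         ≡⟨ ^-*-assoc 2 (suc n) L ⟨
  (2 ^ suc n) ^ L         ≡⟨ cong (_^ L) (*-identityʳ (2 ^ suc n)) ⟨
  (2 ^ suc n * 1) ^ L     ∎)
  where open ≡-Reasoning
prime-factor-lower {p@(suc k@(suc (suc j)))} n p-prime (divides e refl) = begin
  p ^ ((suc n * (e * k)) ÷ k)          ≡⟨ cong (p ^_) ([m*[e*d]]÷d≡m*e (suc n) e (suc j)) ⟩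
  p ^ (suc n * e)                      ≡⟨ ^-*-assoc p (suc n) e ⟨
  (p ^ suc n) ^ e                      ≤⟨ ^-monoˡ-≤ e (Legendre.p^m≤[p^vp[m!]*pm]^k p-prime {suc n} z<s) ⟩
  ((p ^ V * (p * suc n)) ^ k) ^ e      ≡⟨ ^-*-assoc _ k e ⟩
  (p ^ V * (p * suc n)) ^ (k * e)      ≡⟨ cong ((p ^ V * (p * suc n)) ^_) (*-comm k e) ⟩
  (p ^ V * (p * suc n)) ^ (e * k)      ∎
  where
  open ≤-Reasoning
  V = vp p (suc n !)

odd-prime-factor-upper : ∀ {p L} n → Prime p → pred p ∣ L → p ≢ 2 → (p ^ r p n) ^ L ≤ p ^ ((n * L) ÷ pred p)
odd-prime-factor-upper {0} _ (prime {{()}} _) _ _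
odd-prime-factor-upper {1} _ (prime {{()}} _) _ _
odd-prime-factor-upper {2} _ _ _ p≢2 = contradiction refl p≢2
odd-prime-factor-upper {p@(suc k@(suc (suc j)))} n p-prime (divides e refl) _ = begin
  (p ^ V) ^ (e * k)            ≡⟨ ^-*-assoc p V (e * k) ⟩
  p ^ (V * (e * k))            ≡⟨ cong (p ^_) (*-CS.x∙yz≈xz∙y V e k) ⟩
  p ^ (V * k * e)              ≤⟨ ^-monoʳ-≤ p (*-monoˡ-≤ e (s≤s⁻¹ (Legendre.vp[m!]*k<m p-prime {suc n} z<s))) ⟩
  p ^ (n * e)                  ≡⟨ cong (p ^_) ([m*[e*d]]÷d≡m*e n e (suc j)) ⟨
  p ^ ((n * (e * k)) ÷ k)      ∎
  where
  open ≤-Reasoning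
  V = vp p (suc n !)

two-factor-exact : ∀ n L → (2 ^ r 2 n) ^ L ≡ 2 ^ L * 2 ^ ((n * L) ÷ pred 2)
two-factor-exact n L = begin
  (2 ^ suc n) ^ L          ≡⟨ ^-*-assoc 2 (suc n) L ⟩
  2 ^ (L + n * L)          ≡⟨ ^-distribˡ-+-* 2 L (n * L) ⟩
  2 ^ L * 2 ^ (n * L)      ≡⟨ cong (λ x → 2 ^ L * 2 ^ x) (n/1≡n (n * L)) ⟨
  2 ^ L * 2 ^ ((n * L) / 1) ∎
  where open ≡-Reasoning

∈-primeDivisors⁻ : ∀ a {p} → p ∈ primeDivisors a → Prime p × p ∣ a
∈-primeDivisors⁻ a = proj₂ ∘′ ∈-filter⁻ (λ p → prime? p ×-dec (p ∣? a)) {xs = upTo (suc a)}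

primeDivisors-unique : ∀ a → Unique (primeDivisors a)
primeDivisors-unique a = Unique.filter⁺ (λ p → prime? p ×-dec (p ∣? a)) (Unique.upTo⁺ (suc a))

pred∣Lexp : ∀ a {p} → p ∈ primeDivisors a → pred p ∣ Lexp a
pred∣Lexp a = ∈⇒∣product ∘′ ∈-map⁺ pred

alphaPowL[1+n]≤[D*γ*[1+n]^β]^L : ∀ a n → alphaPowL a (suc n) ≤ (D a n * γ a * suc n ^ β a) ^ Lexp a
alphaPowL[1+n]≤[D*γ*[1+n]^β]^L a n = begin
  alphaPowL a (suc n)                                        ≤⟨ product-map-mono-≤ PD factor-lower ⟩
  product (map (λ p → (p ^ r p n * oddWeight n p) ^ L) PD)    ≡⟨ product-map-^ (λ p → p ^ r p n * oddWeight n p) L PD ⟨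
  product (map (λ p → p ^ r p n * oddWeight n p) PD) ^ L      ≡⟨ cong (_^ L) (product-map-* (λ p → p ^ r p n) (oddWeight n) PD) ⟨
  (D a n * product (map (oddWeight n) PD)) ^ L                ≡⟨ cong (λ x → (D a n * x) ^ L) (γ*[1+n]^β≡product-oddWeight a n) ⟨
  (D a n * (γ a * suc n ^ β a)) ^ L                           ≡⟨ cong (_^ L) (*-assoc (D a n) (γ a) _) ⟨
  (D a n * γ a * suc n ^ β a) ^ L                             ∎
  where
  open ≤-Reasoning
  PD = primeDivisors a
  L = Lexp a
  factor-lower : ∀ {p} → p ∈ PD → p ^ ((suc n * L) ÷ pred p) ≤ (p ^ r p n * oddWeight n p) ^ L
  factor-lower p∈PD = prime-factor-lower n (proj₁ (∈-primeDivisors⁻ a p∈PD)) (pred∣Lexp a p∈PD)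

D^L≤gcd[2,a]^L*alphaPowL : ∀ a n → D a n ^ Lexp a ≤ gcd 2 a ^ Lexp a * alphaPowL a n
D^L≤gcd[2,a]^L*alphaPowL a n = begin
  D a n ^ L                                  ≡⟨ product-map-^ (λ p → p ^ r p n) L PD ⟩
  product (map (λ p → (p ^ r p n) ^ L) PD)   ≤⟨ product-map-≤-*-except _≟_ (m^n>0 (gcd 2 a) L) (primeDivisors-unique a) odd-factors factor-two ⟩
  gcd 2 a ^ L * alphaPowL a n                ∎
  where
  open ≤-Reasoning
  PD = primeDivisors a
  L = Lexp a
  instance
    gcd≢0 : NonZero (gcd 2 a)
    gcd≢0 = ≢-nonZero (gcd[m,n]≢0 2 a (inj₁ λ ()))
  odd-factors : ∀ {p} → p ∈ PD → p ≢ 2 → (p ^ r p n) ^ L ≤ p ^ ((n * L) ÷ pred p)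
  odd-factors p∈PD = odd-prime-factor-upper n (proj₁ (∈-primeDivisors⁻ a p∈PD)) (pred∣Lexp a p∈PD)
  factor-two : 2 ∈ PD → (2 ^ r 2 n) ^ L ≤ gcd 2 a ^ L * 2 ^ ((n * L) ÷ pred 2)
  factor-two 2∈PD = ≤-reflexive (trans (two-factor-exact n L) (cong (λ x → x ^ L * 2 ^ ((n * L) ÷ pred 2)) (sym gcd[2,a]≡2)))
    where
    gcd[2,a]≡2 : gcd 2 a ≡ 2
    gcd[2,a]≡2 = ∣-antisym (gcd[m,n]∣m 2 a) (gcd-greatest ∣-refl (proj₂ (∈-primeDivisors⁻ a 2∈PD)))

-- The bounds hold for every a = ∣ s ∣.
lemma2 : (s : ℤ) (t : ℕ) → ∣ s ∣ ≢ 0 → 1 ≤ t → gcd ∣ s ∣ t ≡ 1 → (n : ℕ) →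
    (alphaPowL (∣ s ∣) (suc n) ≤ (D (∣ s ∣) n * γ (∣ s ∣) * suc n ^ β (∣ s ∣)) ^ Lexp (∣ s ∣))
    × (D (∣ s ∣) n ^ Lexp (∣ s ∣) ≤ gcd 2 (∣ s ∣) ^ Lexp (∣ s ∣) * alphaPowL (∣ s ∣) n)
lemma2 s _ _ _ _ n = alphaPowL[1+n]≤[D*γ*[1+n]^β]^L (∣ s ∣) n , D^L≤gcd[2,a]^L*alphaPowL (∣ s ∣) n
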